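{- Let $(a_n)_{n\ge 0}$ be the Narayana sequence, defined by $a_0=0$, $a_1=a_2=1$ and $a_n=a_{n-1}+a_{n-3}$ for all $n\ge 3$. For every integer $i\ge 1$, $$v_3(a_i+1)=\begin{cases} 0, & i\equiv 0,1,2,3,5,6,7 \pmod 8;\\ 1, & i\equiv 4,12 \pmod{24};\\ v_3(i+4)+1, & i\equiv 20 \pmod{24}. \end{cases}$$
   Context: For a prime $p$ and a nonzero integer $x$, $v_p(x)$ denotes the exponent of $p$ in the prime factorization of $x$ (the $p$-adic valuation). -}

module Defs where

open import Data.Nat using (ℕ; zero; suc; _+_; _^_)
open import Data.Nat.Divisibility using (_∣_)
open import Data.Product using (_×_)
open import Relation.Nullary using (¬_)

narayana : ℕ → ℕ
narayana 0 = 0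
narayana 1 = 1
narayana 2 = 1
narayana (suc (suc (suc n))) = narayana (suc (suc n)) + narayana n

-- p-adic valuation as a relation: v_p(x) = k  iff  p^k ∣ x  and  ¬ p^(k+1) ∣ x.
-- (For nonzero x and prime p this pins down k uniquely.)
Val : ℕ → ℕ → ℕ → Set
Val p x k = (p ^ k ∣ x) × ¬ (p ^ suc k ∣ x)

module Submission where

-- In ℤ[α] = ℤ[x]/(x³ − x² − 1) the α²-coefficient of α^(n+1) is the Narayana number a_n, so
-- congruences between Narayana numbers come from congruences between powers of α.
-- Since α⁸ = 1 + 3β, a_(r+8q) ≡ a_r (mod 3), and inspecting r < 8 settles i ≢ 4 (mod 8).
-- Cubing lifts the congruence, (1 + 3κ(b + 3w))³ = 1 + 9κ(b + 3z), so α^(8·3^t) ≡ 1 + 3^(t+1) β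
-- and α^(8·3^t·r) ≡ 1 + 3^(t+1) r β (mod 3^(t+2)). For i = 8m − 4 with m = 3^t r and 3 ∤ r,
-- α^(i+1) = α⁻³ α^(8m), and as α⁻³ = 1 + α − α² and α⁻³β have α²-coefficients −1 and 1,
-- a_i + 1 ≡ 3^(t+1) r (mod 3^(t+2)): v₃(a_i + 1) = t + 1 = v₃(i + 4) + 1.

open import Defs
open import Algebra.Bundles using (CommutativeRing)
open import Algebra.Structures using (IsCommutativeRing)
import Algebra.Properties.Semiring.Exp as Exp
import Algebra.Solver.Ring as RingSolver
import Algebra.Solver.Ring.AlmostCommutativeRing as ACR
open import Data.Integer as ℤ using (ℤ; +_; -[1+_])
import Data.Integer.Properties as ℤ
open import Data.Integer.Solver using (module +-*-Solver)
open import Data.Maybe using (Maybe; map)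
open import Data.Nat using (ℕ; zero; suc; _%_; _≤_)
import Data.Nat as ℕ
import Data.Nat.Properties as ℕ
open import Data.Product using (_×_; _,_; ∃-syntax)
open import Data.Sum using (_⊎_)
open import Level using (0ℓ)
open import Relation.Binary.PropositionalEquality
  using (_≡_; _≢_; refl; sym; trans; cong; cong₂; isEquivalence; module ≡-Reasoning)
open import Relation.Nullary.Decidable using (dec⇒maybe)

module ℤ[α]-Ring where

  record Trinomial (A : Set) : Set where
    constructor ⟨_,_,_⟩
    field
      c₀ c₁ c₂ : A

  open Trinomial public

  -- ⟨ a , b , c ⟩ is a + b α + c α², multiplied using α³ = α² + 1 and α⁴ = α² + α + 1.
  reduced-product : {A : Set} → (A → A → A) → (A → A → A) → Trinomial A → Trinomial A → Trinomial A
  reduced-product _⊕_ _⊗_ ⟨ a , b , c ⟩ ⟨ d , e , f ⟩ =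
    ⟨ ((a ⊗ d) ⊕ (b ⊗ f)) ⊕ ((c ⊗ e) ⊕ (c ⊗ f))
    , ((a ⊗ e) ⊕ (b ⊗ d)) ⊕ (c ⊗ f)
    , (((a ⊗ f) ⊕ (b ⊗ e)) ⊕ (c ⊗ d)) ⊕ (((b ⊗ f) ⊕ (c ⊗ e)) ⊕ (c ⊗ f)) ⟩

  ℤ[α] : Set
  ℤ[α] = Trinomial ℤ

  ι : ℤ → ℤ[α]
  ι a = ⟨ a , + 0 , + 0 ⟩

  0# 1# α α⁻³ β : ℤ[α]
  0# = ι (+ 0)
  1# = ι (+ 1)
  α = ⟨ + 0 , + 1 , + 0 ⟩
  α⁻³ = ⟨ + 1 , + 1 , -[1+ 0 ] ⟩
  β = ⟨ + 1 , + 1 , + 2 ⟩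

  ≡-by-coefficients : {x y : ℤ[α]} → c₀ x ≡ c₀ y → c₁ x ≡ c₁ y → c₂ x ≡ c₂ y → x ≡ y
  ≡-by-coefficients refl refl refl = refl

  private
    module ℤS = +-*-Solver

    infixl 7 _⊛_
    _⊛_ : ∀ {n} → Trinomial (ℤS.Polynomial n) → Trinomial (ℤS.Polynomial n) → Trinomial (ℤS.Polynomial n)
    _⊛_ = reduced-product ℤS._:+_ ℤS._:*_

    ι′ : ∀ {n} → ℤS.Polynomial n → Trinomial (ℤS.Polynomial n)
    ι′ a = ⟨ a , ℤS.con (+ 0) , ℤS.con (+ 0) ⟩

  open import Algebra.Definitions {A = ℤ[α]} _≡_

  infix  8 -_
  infixl 7 _*_
  infixl 6 _+_

  -- Opaque, so that the ring solver below compares normal forms syntactically instead of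
  -- unfolding them into coefficient arithmetic.
  opaque
    _+_ : ℤ[α] → ℤ[α] → ℤ[α]
    ⟨ a , b , c ⟩ + ⟨ d , e , f ⟩ = ⟨ a ℤ.+ d , b ℤ.+ e , c ℤ.+ f ⟩

    _*_ : ℤ[α] → ℤ[α] → ℤ[α]
    _*_ = reduced-product ℤ._+_ ℤ._*_

    -_ : ℤ[α] → ℤ[α]
    - ⟨ a , b , c ⟩ = ⟨ ℤ.- a , ℤ.- b , ℤ.- c ⟩

    +-assoc : Associative _+_
    +-assoc ⟨ a , b , c ⟩ ⟨ d , e , f ⟩ ⟨ g , h , i ⟩ =
      ≡-by-coefficients (ℤ.+-assoc a d g) (ℤ.+-assoc b e h) (ℤ.+-assoc c f i)

    +-comm : Commutative _+_
    +-comm ⟨ a , b , c ⟩ ⟨ d , e , f ⟩ = ≡-by-coefficients (ℤ.+-comm a d) (ℤ.+-comm b e) (ℤ.+-comm c f)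

    +-identityˡ : LeftIdentity 0# _+_
    +-identityˡ ⟨ a , b , c ⟩ = ≡-by-coefficients (ℤ.+-identityˡ a) (ℤ.+-identityˡ b) (ℤ.+-identityˡ c)

    -‿inverseˡ : LeftInverse 0# -_ _+_
    -‿inverseˡ ⟨ a , b , c ⟩ = ≡-by-coefficients (ℤ.+-inverseˡ a) (ℤ.+-inverseˡ b) (ℤ.+-inverseˡ c)

    *-comm : Commutative _*_
    *-comm ⟨ a , b , c ⟩ ⟨ d , e , f ⟩ = ≡-by-coefficients
      (ℤS.solve 6 (λ a b c d e f → c₀ (⟨ a , b , c ⟩ ⊛ ⟨ d , e , f ⟩)
                             ℤS.:= c₀ (⟨ d , e , f ⟩ ⊛ ⟨ a , b , c ⟩)) refl a b c d e f)
      (ℤS.solve 6 (λ a b c d e f → c₁ (⟨ a , b , c ⟩ ⊛ ⟨ d , e , f ⟩)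
                             ℤS.:= c₁ (⟨ d , e , f ⟩ ⊛ ⟨ a , b , c ⟩)) refl a b c d e f)
      (ℤS.solve 6 (λ a b c d e f → c₂ (⟨ a , b , c ⟩ ⊛ ⟨ d , e , f ⟩)
                             ℤS.:= c₂ (⟨ d , e , f ⟩ ⊛ ⟨ a , b , c ⟩)) refl a b c d e f)

    *-assoc : Associative _*_
    *-assoc ⟨ a , b , c ⟩ ⟨ d , e , f ⟩ ⟨ g , h , i ⟩ = ≡-by-coefficients
      (ℤS.solve 9 (λ a b c d e f g h i → c₀ (⟨ a , b , c ⟩ ⊛ ⟨ d , e , f ⟩ ⊛ ⟨ g , h , i ⟩)
                                   ℤS.:= c₀ (⟨ a , b , c ⟩ ⊛ (⟨ d , e , f ⟩ ⊛ ⟨ g , h , i ⟩))) refl a b c d e f g h i)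
      (ℤS.solve 9 (λ a b c d e f g h i → c₁ (⟨ a , b , c ⟩ ⊛ ⟨ d , e , f ⟩ ⊛ ⟨ g , h , i ⟩)
                                   ℤS.:= c₁ (⟨ a , b , c ⟩ ⊛ (⟨ d , e , f ⟩ ⊛ ⟨ g , h , i ⟩))) refl a b c d e f g h i)
      (ℤS.solve 9 (λ a b c d e f g h i → c₂ (⟨ a , b , c ⟩ ⊛ ⟨ d , e , f ⟩ ⊛ ⟨ g , h , i ⟩)
                                   ℤS.:= c₂ (⟨ a , b , c ⟩ ⊛ (⟨ d , e , f ⟩ ⊛ ⟨ g , h , i ⟩))) refl a b c d e f g h i)

    *-identityˡ : LeftIdentity 1# _*_
    *-identityˡ ⟨ a , b , c ⟩ = ≡-by-coefficients
      (ℤS.solve 3 (λ a b c → c₀ (ι′ (ℤS.con (+ 1)) ⊛ ⟨ a , b , c ⟩) ℤS.:= a) refl a b c)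
      (ℤS.solve 3 (λ a b c → c₁ (ι′ (ℤS.con (+ 1)) ⊛ ⟨ a , b , c ⟩) ℤS.:= b) refl a b c)
      (ℤS.solve 3 (λ a b c → c₂ (ι′ (ℤS.con (+ 1)) ⊛ ⟨ a , b , c ⟩) ℤS.:= c) refl a b c)

    *-distribʳ-+ : _*_ DistributesOverʳ _+_
    *-distribʳ-+ ⟨ a , b , c ⟩ ⟨ d , e , f ⟩ ⟨ g , h , i ⟩ = ≡-by-coefficients
      (ℤS.solve 9 (λ a b c d e f g h i → c₀ (⟨ d ℤS.:+ g , e ℤS.:+ h , f ℤS.:+ i ⟩ ⊛ ⟨ a , b , c ⟩)
        ℤS.:= c₀ (⟨ d , e , f ⟩ ⊛ ⟨ a , b , c ⟩) ℤS.:+ c₀ (⟨ g , h , i ⟩ ⊛ ⟨ a , b , c ⟩)) refl a b c d e f g h i)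
      (ℤS.solve 9 (λ a b c d e f g h i → c₁ (⟨ d ℤS.:+ g , e ℤS.:+ h , f ℤS.:+ i ⟩ ⊛ ⟨ a , b , c ⟩)
        ℤS.:= c₁ (⟨ d , e , f ⟩ ⊛ ⟨ a , b , c ⟩) ℤS.:+ c₁ (⟨ g , h , i ⟩ ⊛ ⟨ a , b , c ⟩)) refl a b c d e f g h i)
      (ℤS.solve 9 (λ a b c d e f g h i → c₂ (⟨ d ℤS.:+ g , e ℤS.:+ h , f ℤS.:+ i ⟩ ⊛ ⟨ a , b , c ⟩)
        ℤS.:= c₂ (⟨ d , e , f ⟩ ⊛ ⟨ a , b , c ⟩) ℤS.:+ c₂ (⟨ g , h , i ⟩ ⊛ ⟨ a , b , c ⟩)) refl a b c d e f g h i)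

    ι-+ : ∀ a b → ι (a ℤ.+ b) ≡ ι a + ι b
    ι-+ a b = refl

    ι-* : ∀ a b → ι (a ℤ.* b) ≡ ι a * ι b
    ι-* a b = ≡-by-coefficients
      (ℤS.solve 2 (λ a b → a ℤS.:* b ℤS.:= c₀ (ι′ a ⊛ ι′ b)) refl a b)
      (ℤS.solve 2 (λ a b → ℤS.con (+ 0)
                                   ℤS.:= c₁ (ι′ a ⊛ ι′ b)) refl a b)
      (ℤS.solve 2 (λ a b → ℤS.con (+ 0)
                                   ℤS.:= c₂ (ι′ a ⊛ ι′ b)) refl a b)

    ι-‿ : ∀ a → ι (ℤ.- a) ≡ - ι a
    ι-‿ a = refl

    c₂-+ : ∀ x y → c₂ (x + y) ≡ c₂ x ℤ.+ c₂ y
    c₂-+ ⟨ a , b , c ⟩ ⟨ d , e , f ⟩ = refl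

    c₂-ι* : ∀ a x → c₂ (ι a * x) ≡ a ℤ.* c₂ x
    c₂-ι* a ⟨ d , e , f ⟩ = ℤS.solve 4 (λ a d e f → c₂ (ι′ a ⊛ ⟨ d , e , f ⟩) ℤS.:= a ℤS.:* f) refl a d e f

  +-identityʳ : RightIdentity 0# _+_
  +-identityʳ x = trans (+-comm x 0#) (+-identityˡ x)

  -‿inverseʳ : RightInverse 0# -_ _+_
  -‿inverseʳ x = trans (+-comm x (- x)) (-‿inverseˡ x)

  *-identityʳ : RightIdentity 1# _*_
  *-identityʳ x = trans (*-comm x 1#) (*-identityˡ x)

  *-distribˡ-+ : _*_ DistributesOverˡ _+_
  *-distribˡ-+ x y z = begin
    x * (y + z)     ≡⟨ *-comm x (y + z) ⟩
    (y + z) * x     ≡⟨ *-distribʳ-+ x y z ⟩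
    y * x + z * x   ≡⟨ cong₂ _+_ (*-comm y x) (*-comm z x) ⟩
    x * y + x * z   ∎
    where open ≡-Reasoning

  isCommutativeRing : IsCommutativeRing _≡_ _+_ _*_ -_ 0# 1#
  isCommutativeRing = record
    { isRing = record
      { +-isAbelianGroup = record
        { isGroup = record
          { isMonoid = record
            { isSemigroup = record
              { isMagma = record { isEquivalence = isEquivalence ; ∙-cong = cong₂ _+_ }
              ; assoc = +-assoc
              }
            ; identity = +-identityˡ , +-identityʳ
            }
          ; inverse = -‿inverseˡ , -‿inverseʳ
          ; ⁻¹-cong = cong -_
          }
        ; comm = +-comm
        }
      ; *-cong = cong₂ _*_
      ; *-assoc = *-assoc
      ; *-identity = *-identityˡ , *-identityʳ
      ; distrib = *-distribˡ-+ , *-distribʳ-+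
      }
    ; *-comm = *-comm
    }

  commutativeRing : CommutativeRing 0ℓ 0ℓ
  commutativeRing = record { isCommutativeRing = isCommutativeRing }

  ι-morphism : ℤ.+-*-rawRing ACR.-Raw-AlmostCommutative⟶ ACR.fromCommutativeRing commutativeRing
  ι-morphism = record
    { ⟦_⟧ = ι ; +-homo = ι-+ ; *-homo = ι-* ; -‿homo = ι-‿ ; 0-homo = refl ; 1-homo = refl }

  ι-≟ : ∀ a b → Maybe (ι a ≡ ι b)
  ι-≟ a b = map (cong ι) (dec⇒maybe (a ℤ.≟ b))

  open RingSolver ℤ.+-*-rawRing (ACR.fromCommutativeRing commutativeRing) ι-morphism ι-≟
    using (solve; _:=_; con; _:+_; _:*_; _:^_)
  open Exp (CommutativeRing.semiring commutativeRing) using (_^_; ^-homo-*; ^-assocʳ)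

  opaque
    unfolding _*_

    α^3≡α^2+1 : α ^ 3 ≡ α ^ 2 + 1#
    α^3≡α^2+1 = refl

    α^8≡1+3β : α ^ 8 ≡ 1# + ι (+ 3) * β
    α^8≡1+3β = refl

    α⁻³*α^3≡1 : α⁻³ * α ^ 3 ≡ 1#
    α⁻³*α^3≡1 = refl

    c₂[α⁻³*β]≡1 : c₂ (α⁻³ * β) ≡ + 1
    c₂[α⁻³*β]≡1 = refl

    c₂[α^1]≡0 : c₂ (α ^ 1) ≡ + 0
    c₂[α^1]≡0 = refl

    c₂[α^2]≡1 : c₂ (α ^ 2) ≡ + 1
    c₂[α^2]≡1 = refl

    c₂[α^3]≡1 : c₂ (α ^ 3) ≡ + 1
    c₂[α^3]≡1 = refl

  α^[3+n]≡α^[2+n]+α^n : ∀ n → α ^ (3 ℕ.+ n) ≡ α ^ (2 ℕ.+ n) + α ^ n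
  α^[3+n]≡α^[2+n]+α^n n = begin
    α ^ (3 ℕ.+ n)             ≡⟨ ^-homo-* α 3 n ⟩
    α ^ 3 * α ^ n             ≡⟨ cong (_* α ^ n) α^3≡α^2+1 ⟩
    (α ^ 2 + 1#) * α ^ n      ≡⟨ *-distribʳ-+ (α ^ n) (α ^ 2) 1# ⟩
    α ^ 2 * α ^ n + 1# * α ^ n ≡⟨ cong₂ _+_ (sym (^-homo-* α 2 n)) (*-identityˡ (α ^ n)) ⟩
    α ^ (2 ℕ.+ n) + α ^ n     ∎
    where open ≡-Reasoning

  c₂[α^[1+n]]≡narayana : ∀ n → c₂ (α ^ suc n) ≡ + narayana n
  c₂[α^[1+n]]≡narayana 0 = c₂[α^1]≡0
  c₂[α^[1+n]]≡narayana 1 = c₂[α^2]≡1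
  c₂[α^[1+n]]≡narayana 2 = c₂[α^3]≡1
  c₂[α^[1+n]]≡narayana (suc (suc (suc n))) = begin
    c₂ (α ^ (3 ℕ.+ suc n))                        ≡⟨ cong c₂ (α^[3+n]≡α^[2+n]+α^n (suc n)) ⟩
    c₂ (α ^ (2 ℕ.+ suc n) + α ^ suc n)            ≡⟨ c₂-+ (α ^ (2 ℕ.+ suc n)) (α ^ suc n) ⟩
    c₂ (α ^ (3 ℕ.+ n)) ℤ.+ c₂ (α ^ suc n)
      ≡⟨ cong₂ ℤ._+_ (c₂[α^[1+n]]≡narayana (suc (suc n))) (c₂[α^[1+n]]≡narayana n) ⟩
    + narayana (suc (suc n)) ℤ.+ + narayana n     ∎
    where open ≡-Reasoning

  [1+m*y]^r : ∀ m y r → ∃[ z ] (1# + m * y) ^ r ≡ 1# + m * (ι (+ r) * y + m * z)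
  [1+m*y]^r m y zero = 0# , solve 2 (λ m y → con (+ 1) := con (+ 1) :+ m :* (con (+ 0) :* y :+ m :* con (+ 0))) refl m y
  [1+m*y]^r m y (suc r) with [1+m*y]^r m y r
  ... | z , eq = y * (ι (+ r) * y + m * z) + z , (begin
    (1# + m * y) * (1# + m * y) ^ r                         ≡⟨ cong ((1# + m * y) *_) eq ⟩
    (1# + m * y) * (1# + m * (ι (+ r) * y + m * z))         ≡⟨ step m y (ι (+ r)) z ⟩
    1# + m * ((1# + ι (+ r)) * y + m * (y * (ι (+ r) * y + m * z) + z))
      ≡⟨ cong (λ ρ → 1# + m * (ρ * y + m * (y * (ι (+ r) * y + m * z) + z))) (sym (ι-+ (+ 1) (+ r))) ⟩
    1# + m * (ι (+ suc r) * y + m * (y * (ι (+ r) * y + m * z) + z)) ∎)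
    where
    open ≡-Reasoning
    step : ∀ m y ρ z → (1# + m * y) * (1# + m * (ρ * y + m * z)) ≡ 1# + m * ((1# + ρ) * y + m * (y * (ρ * y + m * z) + z))
    step = solve 4 (λ m y ρ z → (con (+ 1) :+ m :* y) :* (con (+ 1) :+ m :* (ρ :* y :+ m :* z))
                             := con (+ 1) :+ m :* ((con (+ 1) :+ ρ) :* y :+ m :* (y :* (ρ :* y :+ m :* z) :+ z))) refl

  [1+3κ[b+3w]]^3 : ∀ κ b w → ∃[ z ] (1# + ι (+ 3) * κ * (b + ι (+ 3) * w)) ^ 3 ≡ 1# + ι (+ 9) * κ * (b + ι (+ 3) * z)
  [1+3κ[b+3w]]^3 κ b w = w + κ * (b + ι (+ 3) * w) ^ 2 * (1# + κ * (b + ι (+ 3) * w)) ,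
    solve 3 (λ κ b w → (con (+ 1) :+ con (+ 3) :* κ :* (b :+ con (+ 3) :* w)) :^ 3
                    := con (+ 1) :+ con (+ 9) :* κ
                         :* (b :+ con (+ 3) :* (w :+ κ :* (b :+ con (+ 3) :* w) :^ 2 :* (con (+ 1) :+ κ :* (b :+ con (+ 3) :* w)))))
      refl κ b w

  ι[3^[1+t]]≡ι3*ι[3^t] : ∀ t → ι (+ 3 ℕ.^ suc t) ≡ ι (+ 3) * ι (+ 3 ℕ.^ t)
  ι[3^[1+t]]≡ι3*ι[3^t] t = trans (cong ι (ℤ.pos-* 3 (3 ℕ.^ t))) (ι-* (+ 3) (+ 3 ℕ.^ t))

  α^[3^t*8] : ∀ t → ∃[ w ] α ^ (3 ℕ.^ t ℕ.* 8) ≡ 1# + ι (+ 3) * ι (+ 3 ℕ.^ t) * (β + ι (+ 3) * w)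
  α^[3^t*8] zero = 0# , trans α^8≡1+3β
    (solve 1 (λ β → con (+ 1) :+ con (+ 3) :* β := con (+ 1) :+ con (+ 3) :* con (+ 1) :* (β :+ con (+ 3) :* con (+ 0))) refl β)
  α^[3^t*8] (suc t) = lift (α^[3^t*8] t)
    where
    open ≡-Reasoning
    κ : ℤ[α]
    κ = ι (+ 3 ℕ.^ t)
    exponent : 3 ℕ.^ suc t ℕ.* 8 ≡ 3 ℕ.^ t ℕ.* 8 ℕ.* 3
    exponent = trans (cong (ℕ._* 8) (ℕ.*-comm 3 (3 ℕ.^ t)))
                     (trans (ℕ.*-assoc (3 ℕ.^ t) 3 8) (sym (ℕ.*-assoc (3 ℕ.^ t) 8 3)))
    ι9*κ≡ι3*ι3^[1+t] : ι (+ 9) * ι (+ 3 ℕ.^ t) ≡ ι (+ 3) * ι (+ 3 ℕ.^ suc t)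
    ι9*κ≡ι3*ι3^[1+t] = trans (solve 1 (λ κ → con (+ 9) :* κ := con (+ 3) :* (con (+ 3) :* κ)) refl (ι (+ 3 ℕ.^ t)))
                    (cong (ι (+ 3) *_) (sym (ι[3^[1+t]]≡ι3*ι[3^t] t)))
    lift : ∃[ w ] α ^ (3 ℕ.^ t ℕ.* 8) ≡ 1# + ι (+ 3) * κ * (β + ι (+ 3) * w)
         → ∃[ z ] α ^ (3 ℕ.^ suc t ℕ.* 8) ≡ 1# + ι (+ 3) * ι (+ 3 ℕ.^ suc t) * (β + ι (+ 3) * z)
    lift (w , eq) = let (z , eq′) = [1+3κ[b+3w]]^3 κ β w in z , (begin
      α ^ (3 ℕ.^ suc t ℕ.* 8)                         ≡⟨ cong (α ^_) exponent ⟩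
      α ^ (3 ℕ.^ t ℕ.* 8 ℕ.* 3)                       ≡⟨ ^-assocʳ α (3 ℕ.^ t ℕ.* 8) 3 ⟨
      (α ^ (3 ℕ.^ t ℕ.* 8)) ^ 3                       ≡⟨ cong (_^ 3) eq ⟩
      (1# + ι (+ 3) * κ * (β + ι (+ 3) * w)) ^ 3      ≡⟨ eq′ ⟩
      1# + ι (+ 9) * κ * (β + ι (+ 3) * z)            ≡⟨ cong (λ c → 1# + c * (β + ι (+ 3) * z)) ι9*κ≡ι3*ι3^[1+t] ⟩
      1# + ι (+ 3) * ι (+ 3 ℕ.^ suc t) * (β + ι (+ 3) * z) ∎)

  α^[3^t*r*8] : ∀ t r → ∃[ v ] α ^ (3 ℕ.^ t ℕ.* r ℕ.* 8) ≡ 1# + ι (+ 3) * ι (+ 3 ℕ.^ t) * (ι (+ r) * β + ι (+ 3) * v)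
  α^[3^t*r*8] t r =
    let (w , eq) = α^[3^t*8] t
        (z , eq′) = [1+m*y]^r (ι (+ 3) * κ) (β + ι (+ 3) * w) r
    in ι (+ r) * w + κ * z , (begin
      α ^ (3 ℕ.^ t ℕ.* r ℕ.* 8)                                          ≡⟨ cong (α ^_) exponent ⟩
      α ^ (3 ℕ.^ t ℕ.* 8 ℕ.* r)                                          ≡⟨ ^-assocʳ α (3 ℕ.^ t ℕ.* 8) r ⟨
      (α ^ (3 ℕ.^ t ℕ.* 8)) ^ r                                          ≡⟨ cong (_^ r) eq ⟩
      (1# + ι (+ 3) * κ * (β + ι (+ 3) * w)) ^ r                         ≡⟨ eq′ ⟩
      1# + ι (+ 3) * κ * (ι (+ r) * (β + ι (+ 3) * w) + ι (+ 3) * κ * z) ≡⟨ regroup κ (ι (+ r)) w z ⟩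
      1# + ι (+ 3) * κ * (ι (+ r) * β + ι (+ 3) * (ι (+ r) * w + κ * z)) ∎)
    where
    open ≡-Reasoning
    κ : ℤ[α]
    κ = ι (+ 3 ℕ.^ t)
    exponent : 3 ℕ.^ t ℕ.* r ℕ.* 8 ≡ 3 ℕ.^ t ℕ.* 8 ℕ.* r
    exponent = trans (ℕ.*-assoc (3 ℕ.^ t) r 8) (trans (cong (3 ℕ.^ t ℕ.*_) (ℕ.*-comm r 8)) (sym (ℕ.*-assoc (3 ℕ.^ t) 8 r)))
    regroup : ∀ κ ρ w z → 1# + ι (+ 3) * κ * (ρ * (β + ι (+ 3) * w) + ι (+ 3) * κ * z)
                        ≡ 1# + ι (+ 3) * κ * (ρ * β + ι (+ 3) * (ρ * w + κ * z))
    regroup κ ρ w z = solve 5 (λ κ ρ w z β → con (+ 1) :+ con (+ 3) :* κ :* (ρ :* (β :+ con (+ 3) :* w) :+ con (+ 3) :* κ :* z)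
                                          := con (+ 1) :+ con (+ 3) :* κ :* (ρ :* β :+ con (+ 3) :* (ρ :* w :+ κ :* z))) refl κ ρ w z β

  α^[q*8] : ∀ q → ∃[ y ] α ^ (q ℕ.* 8) ≡ 1# + ι (+ 3) * y
  α^[q*8] q =
    let (z , eq) = [1+m*y]^r (ι (+ 3)) β q
    in ι (+ q) * β + ι (+ 3) * z , (begin
      α ^ (q ℕ.* 8)       ≡⟨ cong (α ^_) (ℕ.*-comm q 8) ⟩
      α ^ (8 ℕ.* q)       ≡⟨ ^-assocʳ α 8 q ⟨
      (α ^ 8) ^ q         ≡⟨ cong (_^ q) α^8≡1+3β ⟩
      (1# + ι (+ 3) * β) ^ q ≡⟨ eq ⟩
      1# + ι (+ 3) * (ι (+ q) * β + ι (+ 3) * z) ∎)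
    where open ≡-Reasoning

  α^n≡α⁻³*α^[3+n] : ∀ n → α ^ n ≡ α⁻³ * α ^ (3 ℕ.+ n)
  α^n≡α⁻³*α^[3+n] n = begin
    α ^ n                   ≡⟨ *-identityˡ (α ^ n) ⟨
    1# * α ^ n              ≡⟨ cong (_* α ^ n) α⁻³*α^3≡1 ⟨
    α⁻³ * α ^ 3 * α ^ n     ≡⟨ *-assoc α⁻³ (α ^ 3) (α ^ n) ⟩
    α⁻³ * (α ^ 3 * α ^ n)   ≡⟨ cong (α⁻³ *_) (^-homo-* α 3 n) ⟨
    α⁻³ * α ^ (3 ℕ.+ n)     ∎
    where open ≡-Reasoning

  c₂[x+ιa*y] : ∀ x a y → c₂ (x + ι a * y) ≡ c₂ x ℤ.+ a ℤ.* c₂ y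
  c₂[x+ιa*y] x a y = trans (c₂-+ x (ι a * y)) (cong (ℤ._+_ (c₂ x)) (c₂-ι* a y))

  narayana[r+q*8]+1≡narayana[r]+1+3g : ∀ r q →
    ∃[ g ] + (narayana (r ℕ.+ q ℕ.* 8) ℕ.+ 1) ≡ + (narayana r ℕ.+ 1) ℤ.+ + 3 ℤ.* g
  narayana[r+q*8]+1≡narayana[r]+1+3g r q =
    let (y , eq) = α^[q*8] q
    in c₂ (α ^ suc r * y) , trans (cong (ℤ._+ + 1) (begin
      + narayana (r ℕ.+ q ℕ.* 8)                      ≡⟨ c₂[α^[1+n]]≡narayana (r ℕ.+ q ℕ.* 8) ⟨
      c₂ (α ^ (suc r ℕ.+ q ℕ.* 8))                    ≡⟨ cong c₂ (^-homo-* α (suc r) (q ℕ.* 8)) ⟩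
      c₂ (α ^ suc r * α ^ (q ℕ.* 8))                  ≡⟨ cong (λ e → c₂ (α ^ suc r * e)) eq ⟩
      c₂ (α ^ suc r * (1# + ι (+ 3) * y))             ≡⟨ cong c₂ (distribute (α ^ suc r) y) ⟩
      c₂ (α ^ suc r + ι (+ 3) * (α ^ suc r * y))      ≡⟨ c₂[x+ιa*y] (α ^ suc r) (+ 3) (α ^ suc r * y) ⟩
      c₂ (α ^ suc r) ℤ.+ + 3 ℤ.* c₂ (α ^ suc r * y)   ≡⟨ cong (ℤ._+ (+ 3 ℤ.* c₂ (α ^ suc r * y))) (c₂[α^[1+n]]≡narayana r) ⟩
      + narayana r ℤ.+ + 3 ℤ.* c₂ (α ^ suc r * y)     ∎))
      (move-1 (+ narayana r) (c₂ (α ^ suc r * y)))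
    where
    open ≡-Reasoning
    move-1 : ∀ a g → a ℤ.+ + 3 ℤ.* g ℤ.+ + 1 ≡ a ℤ.+ + 1 ℤ.+ + 3 ℤ.* g
    move-1 = ℤS.solve 2 (λ a g → a ℤS.:+ ℤS.con (+ 3) ℤS.:* g ℤS.:+ ℤS.con (+ 1)
                           ℤS.:= a ℤS.:+ ℤS.con (+ 1) ℤS.:+ ℤS.con (+ 3) ℤS.:* g) refl
    distribute : ∀ x y → x * (1# + ι (+ 3) * y) ≡ x + ι (+ 3) * (x * y)
    distribute = solve 2 (λ x y → x :* (con (+ 1) :+ con (+ 3) :* y) := x :+ con (+ 3) :* (x :* y)) refl

  narayana[4+q*8]+1≡3^[1+t]*[r+3g] : ∀ q t r → suc q ≡ 3 ℕ.^ t ℕ.* r →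
    ∃[ g ] + (narayana (4 ℕ.+ q ℕ.* 8) ℕ.+ 1) ≡ + 3 ℕ.^ suc t ℤ.* (+ r ℤ.+ + 3 ℤ.* g)
  narayana[4+q*8]+1≡3^[1+t]*[r+3g] q t r 1+q≡3^t*r =
    let (v , eq) = α^[3^t*r*8] t r
    in c₂ (α⁻³ * v) , (begin
      + narayana (4 ℕ.+ q ℕ.* 8) ℤ.+ + 1
        ≡⟨ cong (ℤ._+ + 1) (c₂[α^[1+n]]≡narayana (4 ℕ.+ q ℕ.* 8)) ⟨
      c₂ (α ^ suc (4 ℕ.+ q ℕ.* 8)) ℤ.+ + 1
        ≡⟨ cong (λ e → c₂ e ℤ.+ + 1) (α^n≡α⁻³*α^[3+n] (suc (4 ℕ.+ q ℕ.* 8))) ⟩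
      c₂ (α⁻³ * α ^ (suc q ℕ.* 8)) ℤ.+ + 1
        ≡⟨ cong (λ e → c₂ (α⁻³ * α ^ (e ℕ.* 8)) ℤ.+ + 1) 1+q≡3^t*r ⟩
      c₂ (α⁻³ * α ^ (3 ℕ.^ t ℕ.* r ℕ.* 8)) ℤ.+ + 1
        ≡⟨ cong (λ e → c₂ (α⁻³ * e) ℤ.+ + 1) eq ⟩
      c₂ (α⁻³ * (1# + ι (+ 3) * κ * (ι (+ r) * β + ι (+ 3) * v))) ℤ.+ + 1
        ≡⟨ cong (λ e → c₂ e ℤ.+ + 1) (distribute κ (ι (+ r)) v α⁻³ β) ⟩
      c₂ (α⁻³ + ι (+ 3) * κ * (ι (+ r) * (α⁻³ * β) + ι (+ 3) * (α⁻³ * v))) ℤ.+ + 1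
        ≡⟨ cong (λ e → c₂ (α⁻³ + e * (ι (+ r) * (α⁻³ * β) + ι (+ 3) * (α⁻³ * v))) ℤ.+ + 1) (ι[3^[1+t]]≡ι3*ι[3^t] t) ⟨
      c₂ (α⁻³ + ι (+ 3 ℕ.^ suc t) * (ι (+ r) * (α⁻³ * β) + ι (+ 3) * (α⁻³ * v))) ℤ.+ + 1
        ≡⟨ cong (ℤ._+ + 1) (coefficient v) ⟩
      -[1+ 0 ] ℤ.+ + 3 ℕ.^ suc t ℤ.* (+ r ℤ.* + 1 ℤ.+ + 3 ℤ.* c₂ (α⁻³ * v)) ℤ.+ + 1
        ≡⟨ cancel (+ 3 ℕ.^ suc t) (+ r) (c₂ (α⁻³ * v)) ⟩
      + 3 ℕ.^ suc t ℤ.* (+ r ℤ.+ + 3 ℤ.* c₂ (α⁻³ * v)) ∎)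
    where
    open ≡-Reasoning
    κ : ℤ[α]
    κ = ι (+ 3 ℕ.^ t)
    distribute : ∀ κ ρ v u β → u * (1# + ι (+ 3) * κ * (ρ * β + ι (+ 3) * v))
                             ≡ u + ι (+ 3) * κ * (ρ * (u * β) + ι (+ 3) * (u * v))
    distribute = solve 5 (λ κ ρ v u β → u :* (con (+ 1) :+ con (+ 3) :* κ :* (ρ :* β :+ con (+ 3) :* v))
                                     := u :+ con (+ 3) :* κ :* (ρ :* (u :* β) :+ con (+ 3) :* (u :* v))) refl
    coefficient : ∀ v → c₂ (α⁻³ + ι (+ 3 ℕ.^ suc t) * (ι (+ r) * (α⁻³ * β) + ι (+ 3) * (α⁻³ * v)))
                ≡ -[1+ 0 ] ℤ.+ + 3 ℕ.^ suc t ℤ.* (+ r ℤ.* + 1 ℤ.+ + 3 ℤ.* c₂ (α⁻³ * v))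
    coefficient v = begin
      c₂ (α⁻³ + ι (+ 3 ℕ.^ suc t) * (ι (+ r) * (α⁻³ * β) + ι (+ 3) * (α⁻³ * v)))
        ≡⟨ c₂[x+ιa*y] α⁻³ (+ 3 ℕ.^ suc t) (ι (+ r) * (α⁻³ * β) + ι (+ 3) * (α⁻³ * v)) ⟩
      -[1+ 0 ] ℤ.+ + 3 ℕ.^ suc t ℤ.* c₂ (ι (+ r) * (α⁻³ * β) + ι (+ 3) * (α⁻³ * v))
        ≡⟨ cong (λ e → -[1+ 0 ] ℤ.+ + 3 ℕ.^ suc t ℤ.* e) (c₂[x+ιa*y] (ι (+ r) * (α⁻³ * β)) (+ 3) (α⁻³ * v)) ⟩
      -[1+ 0 ] ℤ.+ + 3 ℕ.^ suc t ℤ.* (c₂ (ι (+ r) * (α⁻³ * β)) ℤ.+ + 3 ℤ.* c₂ (α⁻³ * v))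
        ≡⟨ cong (λ e → -[1+ 0 ] ℤ.+ + 3 ℕ.^ suc t ℤ.* (e ℤ.+ + 3 ℤ.* c₂ (α⁻³ * v)))
                (trans (c₂-ι* (+ r) (α⁻³ * β)) (cong (+ r ℤ.*_) c₂[α⁻³*β]≡1)) ⟩
      -[1+ 0 ] ℤ.+ + 3 ℕ.^ suc t ℤ.* (+ r ℤ.* + 1 ℤ.+ + 3 ℤ.* c₂ (α⁻³ * v)) ∎
    cancel : ∀ N r g → -[1+ 0 ] ℤ.+ N ℤ.* (r ℤ.* + 1 ℤ.+ + 3 ℤ.* g) ℤ.+ + 1 ≡ N ℤ.* (r ℤ.+ + 3 ℤ.* g)
    cancel = ℤS.solve 3 (λ N r g → ℤS.con -[1+ 0 ] ℤS.:+ N ℤS.:* (r ℤS.:* ℤS.con (+ 1) ℤS.:+ ℤS.con (+ 3) ℤS.:* g)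
                                  ℤS.:+ ℤS.con (+ 1)
                                  ℤS.:= N ℤS.:* (r ℤS.:+ ℤS.con (+ 3) ℤS.:* g)) refl

open ℤ[α]-Ring using (narayana[r+q*8]+1≡narayana[r]+1+3g; narayana[4+q*8]+1≡3^[1+t]*[r+3g])

open import Data.Nat using (_+_; _*_; _^_; _<_; NonZero; NonTrivial; s≤s; z≤n)
open import Data.Nat.DivMod using (_/_; m≡m%n+[m/n]*n; m%n<n; %-distribˡ-+; m∣n⇒o%n%m≡o%m)
open import Data.Nat.Divisibility
  using ( _∣_; _∣?_; divides; 1∣_; ∣-trans; m∣m*n; *-monoʳ-∣; *-cancelˡ-∣; %-presˡ-∣
        ; quotient; quotient-<; quotient≢0; m∣n⇒n≡m*quotient)
open import Data.Nat.Induction using (<-wellFounded)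
open import Data.Nat.Primality using (prime?; euclidsLemma)
import Data.Integer.Divisibility.Signed as ℤ
open import Data.Product using (∃₂)
open import Data.Sum using (inj₁; inj₂; [_,_]′)
open import Data.Empty using (⊥-elim)
open import Induction.WellFounded using (Acc; acc)
open import Relation.Binary.Definitions using (tri<; tri≈; tri>)
open import Relation.Binary.PropositionalEquality using (subst)
open import Relation.Nullary using (¬_; yes; no)
open import Relation.Nullary.Decidable using (from-yes; from-no)
open import Relation.Nullary.Negation using (contradiction)

p^m∣p^n : ∀ p {m n} → m ≤ n → p ^ m ∣ p ^ n
p^m∣p^n p {n = n} z≤n = 1∣ (p ^ n)
p^m∣p^n p (s≤s m≤n) = *-monoʳ-∣ p (p^m∣p^n p m≤n)

Val-unique : ∀ {p x k l} → Val p x k → Val p x l → k ≡ l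
Val-unique {p} {k = k} {l} (p^k∣x , p^[1+k]∤x) (p^l∣x , p^[1+l]∤x) with ℕ.<-cmp k l
... | tri< k<l _ _ = contradiction (∣-trans (p^m∣p^n p k<l) p^l∣x) p^[1+k]∤x
... | tri≈ _ k≡l _ = k≡l
... | tri> _ _ l<k = contradiction (∣-trans (p^m∣p^n p l<k) p^k∣x) p^[1+l]∤x

Val-p^t*r : ∀ {p} t {r} .{{_ : NonZero p}} → ¬ p ∣ r → Val p (p ^ t * r) t
Val-p^t*r {p} t {r} p∤r = m∣m*n r , λ p^[1+t]∣p^t*r →
  p∤r (*-cancelˡ-∣ (p ^ t) {{ℕ.m^n≢0 p t}} (subst (_∣ p ^ t * r) (ℕ.*-comm p (p ^ t)) p^[1+t]∣p^t*r))

p-adic-decomposition : ∀ p .{{_ : NonTrivial p}} n .{{_ : NonZero n}} → ∃₂ λ t r → n ≡ p ^ t * r × ¬ p ∣ r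
p-adic-decomposition p n = go n (<-wellFounded n)
  where
  go : ∀ n → Acc _<_ n → .{{_ : NonZero n}} → ∃₂ λ t r → n ≡ p ^ t * r × ¬ p ∣ r
  go n (acc rec) with p ∣? n
  ... | no p∤n = 0 , n , sym (ℕ.*-identityˡ n) , p∤n
  ... | yes p∣n with go (quotient p∣n) (rec (quotient-< p∣n)) {{quotient≢0 p∣n}}
  ...   | t , r , n/p≡p^t*r , p∤r =
    suc t , r , trans (m∣n⇒n≡m*quotient p∣n) (trans (cong (p *_) n/p≡p^t*r) (sym (ℕ.*-assoc p (p ^ t) r))) , p∤r

Val-from-ℤ : ∀ {p n t r} g .{{_ : NonZero p}} → + n ≡ + p ^ t ℤ.* (+ r ℤ.+ + p ℤ.* g) → ¬ p ∣ r → Val p n t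
Val-from-ℤ {p} {n} {t} {r} g eq p∤r = subst (λ m → Val p m t) (sym n≡p^t*s) (Val-p^t*r t p∤s)
  where
  s : ℕ
  s = ℤ.∣ + r ℤ.+ + p ℤ.* g ∣
  n≡p^t*s : n ≡ p ^ t * s
  n≡p^t*s = trans (cong ℤ.∣_∣ eq) (ℤ.abs-* (+ p ^ t) (+ r ℤ.+ + p ℤ.* g))
  p∤s : ¬ p ∣ s
  p∤s p∣s = p∤r (ℤ.∣⇒∣ᵤ (ℤ.∣m+n∣n⇒∣m {+ p} {+ r}
    (ℤ.∣ᵤ⇒∣ {+ p} {+ r ℤ.+ + p ℤ.* g} p∣s) (ℤ.∣m⇒∣m*n g ℤ.∣-refl)))

∣-cong-mod : ∀ {d a b} g → + a ≡ + b ℤ.+ + d ℤ.* g → d ∣ a → d ∣ b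
∣-cong-mod {d} {a} {b} g eq d∣a =
  ℤ.∣⇒∣ᵤ (ℤ.∣m+n∣n⇒∣m {+ d} {+ b}
    (subst (+ d ℤ.∣_) eq (ℤ.∣ᵤ⇒∣ {+ d} {+ a} d∣a)) (ℤ.∣m⇒∣m*n {+ d} {+ d} g ℤ.∣-refl))

3∤narayana[r]+1 : ∀ r → r < 8 → r ≢ 4 → ¬ 3 ∣ narayana r + 1
3∤narayana[r]+1 0 _ _ = from-no (3 ∣? 1)
3∤narayana[r]+1 1 _ _ = from-no (3 ∣? 2)
3∤narayana[r]+1 2 _ _ = from-no (3 ∣? 2)
3∤narayana[r]+1 3 _ _ = from-no (3 ∣? 2)
3∤narayana[r]+1 4 _ r≢4 = ⊥-elim (r≢4 refl)
3∤narayana[r]+1 5 _ _ = from-no (3 ∣? 4)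
3∤narayana[r]+1 6 _ _ = from-no (3 ∣? 5)
3∤narayana[r]+1 7 _ _ = from-no (3 ∣? 7)
3∤narayana[r]+1 (suc (suc (suc (suc (suc (suc (suc (suc _)))))))) (s≤s (s≤s (s≤s (s≤s (s≤s (s≤s (s≤s (s≤s ())))))))) _

v₃[narayana[i]+1]≡0 : ∀ i → i % 8 ≢ 4 → Val 3 (narayana i + 1) 0
v₃[narayana[i]+1]≡0 i i%8≢4 = 1∣ (narayana i + 1) , λ 3∣narayana[i]+1 →
  let (g , eq) = narayana[r+q*8]+1≡narayana[r]+1+3g (i % 8) (i / 8)
  in 3∤narayana[r]+1 (i % 8) (m%n<n i 8) i%8≢4
       (∣-cong-mod g eq (subst (λ j → 3 ∣ narayana j + 1) (m≡m%n+[m/n]*n i 8) 3∣narayana[i]+1))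

v₃[narayana[4+q*8]+1]≡1+v₃[[1+q]*8] : ∀ q k → Val 3 (suc q * 8) k → Val 3 (narayana (4 + q * 8) + 1) (suc k)
v₃[narayana[4+q*8]+1]≡1+v₃[[1+q]*8] q k v₃[[1+q]*8]≡k = from-decomposition (p-adic-decomposition 3 (suc q))
  where
  from-decomposition : (∃₂ λ t r → suc q ≡ 3 ^ t * r × ¬ 3 ∣ r) → Val 3 (narayana (4 + q * 8) + 1) (suc k)
  from-decomposition (t , r , 1+q≡3^t*r , 3∤r) =
    let (g , eq) = narayana[4+q*8]+1≡3^[1+t]*[r+3g] q t r 1+q≡3^t*r
    in subst (λ l → Val 3 (narayana (4 + q * 8) + 1) (suc l))
             (Val-unique {3} {suc q * 8} {t} {k} v₃[[1+q]*8]≡t v₃[[1+q]*8]≡k)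
             (Val-from-ℤ {3} {t = suc t} g eq 3∤r)
    where
    3∤r*8 : ¬ 3 ∣ r * 8
    3∤r*8 3∣r*8 = [ 3∤r , from-no (3 ∣? 8) ]′ (euclidsLemma r 8 (from-yes (prime? 3)) 3∣r*8)
    [1+q]*8≡3^t*[r*8] : suc q * 8 ≡ 3 ^ t * (r * 8)
    [1+q]*8≡3^t*[r*8] = trans (cong (_* 8) 1+q≡3^t*r) (ℕ.*-assoc (3 ^ t) r 8)
    v₃[[1+q]*8]≡t : Val 3 (suc q * 8) t
    v₃[[1+q]*8]≡t = subst (λ n → Val 3 n t) (sym [1+q]*8≡3^t*[r*8]) (Val-p^t*r t 3∤r*8)

v₃[narayana[i]+1]≡1+v₃[i+4] : ∀ i → i % 8 ≡ 4 → ∀ k → Val 3 (i + 4) k → Val 3 (narayana i + 1) (suc k)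
v₃[narayana[i]+1]≡1+v₃[i+4] i i%8≡4 k v₃[i+4]≡k =
  subst (λ j → Val 3 (narayana j + 1) (suc k)) (sym i≡4+q*8)
    (v₃[narayana[4+q*8]+1]≡1+v₃[[1+q]*8] (i / 8) k
      (subst (λ n → Val 3 n k) (trans (cong (_+ 4) i≡4+q*8) (ℕ.+-comm (4 + i / 8 * 8) 4)) v₃[i+4]≡k))
  where
  i≡4+q*8 : i ≡ 4 + i / 8 * 8
  i≡4+q*8 = trans (m≡m%n+[m/n]*n i 8) (cong (_+ i / 8 * 8) i%8≡4)

i%24≡a⇒i%8≡a%8 : ∀ i {a} → i % 24 ≡ a → i % 8 ≡ a % 8
i%24≡a⇒i%8≡a%8 i i%24≡a = trans (sym (m∣n⇒o%n%m≡o%m 8 24 i (divides 3 refl))) (cong (_% 8) i%24≡a)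

3∣i+4⇒3∣[i%24+4]%24 : ∀ i → 3 ∣ i + 4 → 3 ∣ (i % 24 + 4) % 24
3∣i+4⇒3∣[i%24+4]%24 i 3∣i+4 = subst (3 ∣_) (%-distribˡ-+ i 4 24) (%-presˡ-∣ 3∣i+4 (divides 8 refl))

v₃[i+4]≡0 : ∀ i → i % 24 ≡ 4 ⊎ i % 24 ≡ 12 → Val 3 (i + 4) 0
v₃[i+4]≡0 i i%24∈ = 1∣ (i + 4) , 3∤i+4 i%24∈
  where
  3∤i+4 : i % 24 ≡ 4 ⊎ i % 24 ≡ 12 → ¬ 3 ∣ i + 4
  3∤i+4 (inj₁ i%24≡4) 3∣i+4 =
    from-no (3 ∣? 8) (subst (λ a → 3 ∣ (a + 4) % 24) i%24≡4 (3∣i+4⇒3∣[i%24+4]%24 i 3∣i+4))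
  3∤i+4 (inj₂ i%24≡12) 3∣i+4 =
    from-no (3 ∣? 16) (subst (λ a → 3 ∣ (a + 4) % 24) i%24≡12 (3∣i+4⇒3∣[i%24+4]%24 i 3∣i+4))

theorem3p6 : (i : ℕ) → 1 ≤ i →
    ((i % 8 ≢ 4) → Val 3 (narayana i + 1) 0)
    × ((i % 24 ≡ 4 ⊎ i % 24 ≡ 12) → Val 3 (narayana i + 1) 1)
    × (i % 24 ≡ 20 → (k : ℕ) → Val 3 (i + 4) k → Val 3 (narayana i + 1) (suc k))
theorem3p6 i _ =
    v₃[narayana[i]+1]≡0 i
  , (λ i%24∈ → v₃[narayana[i]+1]≡1+v₃[i+4] i (i%8≡4 i%24∈) 0 (v₃[i+4]≡0 i i%24∈))
  , λ i%24≡20 → v₃[narayana[i]+1]≡1+v₃[i+4] i (i%24≡a⇒i%8≡a%8 i i%24≡20)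
  where
  i%8≡4 : i % 24 ≡ 4 ⊎ i % 24 ≡ 12 → i % 8 ≡ 4
  i%8≡4 (inj₁ i%24≡4) = i%24≡a⇒i%8≡a%8 i i%24≡4
  i%8≡4 (inj₂ i%24≡12) = i%24≡a⇒i%8≡a%8 i i%24≡12
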